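{- For all bouquets $\Phi,\Psi$: $\Phi\to^*\Psi$ holds if and only if $(\Psi\rhd\Phi)\to^*\emptyset$, where $\to^*$ is derivability in the full flower calculus $\mathsf N\cup\mathsf C$.
   Context: Fix a countable set $\mathcal{V}$ of variables and a first-order signature consisting of a countable set $\mathcal{P}$ of predicate symbols with an arity function $\mathrm{ar}:\mathcal{P}\to\mathbb{N}$. Flowers and gardens are defined by mutual induction: (1) if $p\in\mathcal{P}$ and $\vec{x}\in\mathcal{V}^{\mathrm{ar}(p)}$, then the atom $p(\vec{x})$ is a flower; (2) if $\mathbf{x}\subset\mathcal{V}$ is a finite set (a sprinkler; its elements are binders) and $\Phi$ is a finite multiset of flowers (a bouquet), then $\mathbf{x}\cdot\Phi$ is a garden; (3) if $\gamma$ is a garden (the pistil) and $\Delta$ is a finite multiset of gardens (a corolla, whose elements are petals), then $\gamma\rhd\Delta$ is a flower, also written $\gamma\rhd\delta_1;\dots;\delta_n$ when $\Delta=\{\delta_1,\dots,\delta_n\}$. A garden $\emptyset\cdot\Phi$ is written simply $\Phi$; the empty bouquet is $\emptyset$; a comma denotes multiset union of bouquets (a flower being identified with a singleton bouquet); $\mathbf{x},\mathbf{y}$ denotes $\mathbf{x}\cup\mathbf{y}$. For bouquets $\Psi,\Phi$, $(\Psi\rhd\Phi)$ denotes the flower with pistil $\emptyset\cdot\Psi$ and single petal $\emptyset\cdot\Phi$. Free variables: $\mathrm{fv}(p(\vec x))$ is the set of variables in $\vec x$; $\mathrm{fv}(\Phi)=\bigcup_{\phi\in\Phi}\mathrm{fv}(\phi)$;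 $\mathrm{fv}(\mathbf{x}\cdot\Phi)=\mathrm{fv}(\Phi)\setminus\mathbf{x}$; $\mathrm{fv}(\mathbf{x}\cdot\Phi\rhd\Delta)=\mathrm{fv}(\mathbf{x}\cdot\Phi)\cup\bigcup_{\mathbf{y}\cdot\Psi\in\Delta}\mathrm{fv}((\mathbf{x}\cup\mathbf{y})\cdot\Psi)$. Bound variables: $\mathrm{bv}(p(\vec x))=\emptyset$; $\mathrm{bv}(\Phi)=\bigcup_{\phi\in\Phi}\mathrm{bv}(\phi)$; $\mathrm{bv}(\mathbf{x}\cdot\Phi)=\mathbf{x}\cup\mathrm{bv}(\Phi)$; $\mathrm{bv}(\gamma\rhd\Delta)=\mathrm{bv}(\gamma)\cup\bigcup_{\delta\in\Delta}\mathrm{bv}(\delta)$. Standing convention: every bouquet $\Phi$ considered has pairwise distinct binders and satisfies $\mathrm{bv}(\Phi)\cap\mathrm{fv}(\Phi)=\emptyset$. Substitutions: for $f,g:A\to B$ and $R\subseteq A$, $f[R\mapsto g]$ equals $g$ on $R$ and $f$ elsewhere (left-associative; omitted $f$ or $g$ means identity). A substitution is $\sigma:\mathcal V\to\mathcal V$ with finite support $\{x\mid\sigma(x)\ne x\}$; $\sigma:\mathbf y$ means its support is $\mathbf y$; $\sigma_{ -\mathbf x}:=\sigma[\mathbf x\mapsto\mathrm{id}]$. Action: $\sigma(p(x_1,\dots,x_n))=p(\sigma(x_1),\dots,\sigma(x_n))$, elementwise on bouquets, $\sigma(\mathbf x\cdot\Phi)=\mathbf x\cdot\sigma_{ -\mathbf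 x}(\Phi)$, $\sigma(\mathbf x\cdot\Phi\rhd\delta_1;\dots;\delta_n)=\sigma(\mathbf x\cdot\Phi)\rhd\sigma_{ -\mathbf x}(\delta_1);\dots;\sigma_{ -\mathbf x}(\delta_n)$. $\sigma:\mathbf y$ is capture-avoiding in $\Phi$ if $\sigma(\mathbf y)\cap\mathrm{bv}(\Phi)=\emptyset$. Contexts: $\Xi::=\Psi,\xi$ and $\xi::=\Box\mid(\mathbf x\cdot\Xi\rhd\Delta)\mid(\gamma\rhd\mathbf x\cdot\Xi;\Delta)$ ($\Psi$ a bouquet, $\gamma$ a garden, $\Delta$ a corolla). $\Xi\{\Psi\}$ replaces the hole $\Box$ by the bouquet $\Psi$, $\Xi\{\}$ by $\emptyset$, $\Xi\{\Xi'\}$ by a context $\Xi'$. Inversions: $\mathrm{inv}(\Box)=0$, $\mathrm{inv}(\Psi,\xi)=\mathrm{inv}(\xi)$, $\mathrm{inv}(\mathbf x\cdot\Xi\rhd\Delta)=1+\mathrm{inv}(\Xi)$, $\mathrm{inv}(\gamma\rhd\mathbf x\cdot\Xi;\Delta)=\mathrm{inv}(\Xi)$; $\Xi$ is positive ($\Xi^+$) if this is even, negative ($\Xi^-$) otherwise. A flower $\phi$ can be pollinated in $\Xi$ if there are a bouquet $\Psi\ni\phi$ and contexts $\Xi',\Xi_0$ with either $\Xi=\Xi'\{\Psi,\Xi_0\}$ or $\Xi=\Xi'\{\mathbf x\cdot\Psi\rhd\mathbf y\cdot\Xi_0;\Delta\}$ for some $\mathbf x,\mathbf y,\Delta$; a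 bouquet can be pollinated in $\Xi$ if each of its flowers can. Rules (steps $\Phi\to\Psi$, $\Phi$ the conclusion, $\Psi$ the premiss). Natural rules $\mathsf N$: (poll↓) $\Xi\{\Phi\}\to\Xi\{\}$ and (poll↑) $\Xi\{\}\to\Xi\{\Phi\}$ whenever $\Phi$ can be pollinated in $\Xi$; (epis) $\Phi\to(\emptyset\cdot\emptyset\rhd\emptyset\cdot\Phi)$; (epet) $(\gamma\rhd\emptyset\cdot\emptyset;\Delta)\to\emptyset$; (srep) $(\mathbf x\cdot(\Phi,(\emptyset\cdot\emptyset\rhd\gamma_1;\dots;\gamma_n))\rhd\Delta)\to(\mathbf x\cdot\Phi\rhd\emptyset\cdot\{(\gamma_1\rhd\Delta),\dots,(\gamma_n\rhd\Delta)\})$; (ipis) $(\mathbf x,\mathbf y\cdot\Phi\rhd\Delta)\to(\mathbf x\cdot\sigma(\Phi)\rhd\sigma(\Delta)),(\mathbf x,\mathbf y\cdot\Phi\rhd\Delta)$; (ipet) $(\gamma\rhd\mathbf x,\mathbf y\cdot\Phi;\Delta)\to(\gamma\rhd\mathbf x\cdot\sigma(\Phi);\mathbf x,\mathbf y\cdot\Phi;\Delta)$. Cultural rules $\mathsf C$: (grow) $\Xi^+\{\}\to\Xi^+\{\Phi\}$; (crop) $\Xi^-\{\Phi\}\to\Xi^-\{\}$; (pull) $\Xi^+\{\gamma\rhd\Gamma;\Delta\}\to\Xi^+\{\gamma\rhd\Delta\}$; (glue) $\Xi^-\{\gamma\rhd\Delta\}\to\Xi^-\{\gamma\rhd\Gamma;\Delta\}$;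 (apis) $\Xi^+\{\mathbf x\cdot\sigma(\Phi)\rhd\sigma(\Delta)\}\to\Xi^+\{\mathbf x,\mathbf y\cdot\Phi\rhd\Delta\}$; (apet) $\Xi^-\{\gamma\rhd\mathbf x\cdot\sigma(\Phi);\Delta\}\to\Xi^-\{\gamma\rhd\mathbf x,\mathbf y\cdot\Phi;\Delta\}$. In ipis/apis, $\sigma:\mathbf y$ is capture-avoiding in $(\emptyset\cdot\Phi\rhd\Delta)$; in ipet/apet, $\sigma:\mathbf y$ is capture-avoiding in $\Phi$. Natural steps are closed under arbitrary contexts: if $\Phi\to\Psi$ is an instance of an $\mathsf N$-rule then $\Xi\{\Phi\}\to_{\mathsf N}\Xi\{\Psi\}$ for every context $\Xi$. For a rule set $\mathsf R$, $\Phi\to^*_{\mathsf R}\Psi$ means a finite (possibly empty) sequence of $\mathsf R$-steps from $\Phi$ to $\Psi$; $\to^*$ without subscript means $\mathsf N\cup\mathsf C$. -}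

module Defs where

-- Finite multisets are represented by lists; multiset equality (and the
-- set nature of sprinklers) is recovered by explicit structural
-- equivalence steps `Equiv`, which may be used anywhere in a derivation.

open import Data.Nat using (ℕ; zero; suc; _%_)
open import Data.Nat.Properties using (_≟_)
open import Data.List using (List; []; _∷_; _++_; [_]; map; deduplicate)
open import Data.List.Membership.Propositional using (_∈_; _∉_)
open import Data.List.Membership.DecPropositional _≟_ using (_∈?_)
open import Data.List.Relation.Unary.All using (All)
open import Data.List.Relation.Unary.Unique.Propositional using (Unique)
open import Data.List.Relation.Binary.Permutation.Propositional using (_↭_)
open import Data.List.Relation.Binary.Subset.Propositional using (_⊆_)
open import Data.Vec using (Vec; toList)
import Data.Vec as Vec
open import Data.Product using (Σ; _×_)
open import Data.Sum using (_⊎_)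
open import Data.Empty using (⊥)
open import Relation.Nullary using (¬_; yes; no)
open import Relation.Binary.PropositionalEquality using (_≡_; _≢_)
open import Relation.Binary.Construct.Closure.ReflexiveTransitive using (Star)

Var : Set
Var = ℕ

-- A sprinkler: a finite set of variables, represented by a list
-- (order/duplicates irrelevant up to `Equiv`).
Sprinkler : Set
Sprinkler = List Var

infix 6 _·_
infix 5 _▷_

data Flower {P : Set} (ar : P → ℕ) : Set
data Garden {P : Set} (ar : P → ℕ) : Set

data Flower {P} ar where
  atom : (p : P) → Vec Var (ar p) → Flower ar
  _▷_  : Garden ar → List (Garden ar) → Flower ar

data Garden {P} ar where
  _·_ : Sprinkler → List (Flower ar) → Garden ar

Bouquet : {P : Set} → (P → ℕ) → Set
Bouquet ar = List (Flower ar)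

Corolla : {P : Set} → (P → ℕ) → Set
Corolla ar = List (Garden ar)

-- Contexts  Ξ ::= Ψ , ξ      ξ ::= □ | (x·Ξ ▷ Δ) | (γ ▷ x·Ξ ; Δ)
infixr 4 _⸴_
data Ctx {P : Set} (ar : P → ℕ) : Set
data Ctx₀ {P : Set} (ar : P → ℕ) : Set

data Ctx {P} ar where
  _⸴_ : Bouquet ar → Ctx₀ ar → Ctx ar

data Ctx₀ {P} ar where
  □   : Ctx₀ ar
  pis : Sprinkler → Ctx ar → Corolla ar → Ctx₀ ar
  pet : Garden ar → Sprinkler → Ctx ar → Corolla ar → Ctx₀ ar

Subst : Set
Subst = Var → Var

_−_ : Subst → Sprinkler → Subst
(σ − xs) z with z ∈? xs
... | yes _ = z
... | no _  = σ z

_∶_ : Subst → Sprinkler → Set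
σ ∶ ys = ∀ z → (σ z ≢ z → z ∈ ys) × (z ∈ ys → σ z ≢ z)

module _ {P : Set} {ar : P → ℕ} where

  FvF  : Var → Flower ar → Set
  FvB  : Var → Bouquet ar → Set
  FvS  : Var → Sprinkler → Bouquet ar → Set
  FvCp : Var → Sprinkler → Corolla ar → Set

  FvF z (atom p xs) = z ∈ toList xs
  FvF z ((xs · Φ) ▷ Δ) = FvS z xs Φ ⊎ FvCp z xs Δ
  FvB z [] = ⊥
  FvB z (φ ∷ Φ) = FvF z φ ⊎ FvB z Φ
  FvS z xs Φ = z ∉ xs × FvB z Φ
  FvCp z xs [] = ⊥
  FvCp z xs ((ys · Ψ) ∷ Δ) = FvS z (xs ++ ys) Ψ ⊎ FvCp z xs Δ

  BvF : Var → Flower ar → Set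
  BvG : Var → Garden ar → Set
  BvB : Var → Bouquet ar → Set
  BvC : Var → Corolla ar → Set

  BvF z (atom p xs) = ⊥
  BvF z (γ ▷ Δ) = BvG z γ ⊎ BvC z Δ
  BvG z (xs · Φ) = z ∈ xs ⊎ BvB z Φ
  BvB z [] = ⊥
  BvB z (φ ∷ Φ) = BvF z φ ⊎ BvB z Φ
  BvC z [] = ⊥
  BvC z (γ ∷ Δ) = BvG z γ ⊎ BvC z Δ

  -- list of all binder occurrences (each sprinkler taken as a set)
  bindF : Flower ar → List Var
  bindG : Garden ar → List Var
  bindB : Bouquet ar → List Var
  bindC : Corolla ar → List Var

  bindF (atom p xs) = []
  bindF (γ ▷ Δ) = bindG γ ++ bindC Δ
  bindG (xs · Φ) = deduplicate _≟_ xs ++ bindB Φ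
  bindB [] = []
  bindB (φ ∷ Φ) = bindF φ ++ bindB Φ
  bindC [] = []
  bindC (γ ∷ Δ) = bindG γ ++ bindC Δ

  WF : Bouquet ar → Set
  WF Φ = Unique (bindB Φ) × (∀ z → BvB z Φ → ¬ FvB z Φ)

  sF : Subst → Flower ar → Flower ar
  sG : Subst → Garden ar → Garden ar
  sB : Subst → Bouquet ar → Bouquet ar
  sC : Subst → Corolla ar → Corolla ar

  sF σ (atom p xs) = atom p (Vec.map σ xs)
  sF σ ((xs · Φ) ▷ Δ) = sG σ (xs · Φ) ▷ sC (σ − xs) Δ
  sG σ (xs · Φ) = xs · sB (σ − xs) Φ
  sB σ [] = []
  sB σ (φ ∷ Φ) = sF σ φ ∷ sB σ Φ
  sC σ [] = []
  sC σ (γ ∷ Δ) = sG σ γ ∷ sC σ Δ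

  CapAvoidF : Subst → Sprinkler → Flower ar → Set
  CapAvoidF σ ys φ = ∀ z → z ∈ ys → ¬ BvF (σ z) φ

  CapAvoidB : Subst → Sprinkler → Bouquet ar → Set
  CapAvoidB σ ys Φ = ∀ z → z ∈ ys → ¬ BvB (σ z) Φ

  _⊳_ : Bouquet ar → Bouquet ar → Flower ar
  Ψ ⊳ Φ = ([] · Ψ) ▷ [ [] · Φ ]

  _⟦_⟧  : Ctx ar → Bouquet ar → Bouquet ar
  _⟦_⟧₀ : Ctx₀ ar → Bouquet ar → Bouquet ar
  (Ψ ⸴ ξ) ⟦ Φ ⟧ = Ψ ++ (ξ ⟦ Φ ⟧₀)
  □ ⟦ Φ ⟧₀ = Φ
  pis xs Ξ Δ ⟦ Φ ⟧₀ = [ (xs · (Ξ ⟦ Φ ⟧)) ▷ Δ ]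
  pet γ ys Ξ Δ ⟦ Φ ⟧₀ = [ γ ▷ ((ys · (Ξ ⟦ Φ ⟧)) ∷ Δ) ]

  _∘ᶜ_ : Ctx ar → Ctx ar → Ctx ar
  (Ψ ⸴ □) ∘ᶜ (Ψ' ⸴ ξ') = (Ψ ++ Ψ') ⸴ ξ'
  (Ψ ⸴ pis xs Ξ Δ) ∘ᶜ Ξ' = Ψ ⸴ pis xs (Ξ ∘ᶜ Ξ') Δ
  (Ψ ⸴ pet γ ys Ξ Δ) ∘ᶜ Ξ' = Ψ ⸴ pet γ ys (Ξ ∘ᶜ Ξ') Δ

  _⊕_ : Bouquet ar → Ctx ar → Ctx ar
  Ψ ⊕ (Ψ' ⸴ ξ) = (Ψ ++ Ψ') ⸴ ξ

  inv  : Ctx ar → ℕ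
  inv₀ : Ctx₀ ar → ℕ
  inv (Ψ ⸴ ξ) = inv₀ ξ
  inv₀ □ = zero
  inv₀ (pis xs Ξ Δ) = suc (inv Ξ)
  inv₀ (pet γ ys Ξ Δ) = inv Ξ

  Positive : Ctx ar → Set
  Positive Ξ = inv Ξ % 2 ≡ 0

  Negative : Ctx ar → Set
  Negative Ξ = inv Ξ % 2 ≡ 1

  CanPoll : Flower ar → Ctx ar → Set
  CanPoll φ Ξ =
    Σ (Bouquet ar) λ Ψ → φ ∈ Ψ × Σ (Ctx ar) λ Ξ' → Σ (Ctx ar) λ Ξ₀ →
      (Ξ ≡ Ξ' ∘ᶜ (Ψ ⊕ Ξ₀))
      ⊎ (Σ Sprinkler λ xs → Σ Sprinkler λ ys → Σ (Corolla ar) λ Δ →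
           Ξ ≡ Ξ' ∘ᶜ ([] ⸴ pet (xs · Ψ) ys Ξ₀ Δ))

  Pollinable : Bouquet ar → Ctx ar → Set
  Pollinable Φ Ξ = All (λ φ → CanPoll φ Ξ) Φ

  -- instances of natural rules (conclusion first, premiss second)
  data NRule : Bouquet ar → Bouquet ar → Set where
    poll↓ : (Ξ : Ctx ar) (Φ : Bouquet ar) → Pollinable Φ Ξ → NRule (Ξ ⟦ Φ ⟧) (Ξ ⟦ [] ⟧)
    poll↑ : (Ξ : Ctx ar) (Φ : Bouquet ar) → Pollinable Φ Ξ → NRule (Ξ ⟦ [] ⟧) (Ξ ⟦ Φ ⟧)
    epis  : (Φ : Bouquet ar) → NRule Φ [ ([] · []) ▷ [ [] · Φ ] ]
    epet  : (γ : Garden ar) (Δ : Corolla ar) → NRule [ γ ▷ (([] · []) ∷ Δ) ] []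
    srep  : (xs : Sprinkler) (Φ : Bouquet ar) (γs Δ : Corolla ar) →
            NRule [ (xs · (Φ ++ [ ([] · []) ▷ γs ])) ▷ Δ ]
                  [ (xs · Φ) ▷ [ [] · map (λ γ → γ ▷ Δ) γs ] ]
    ipis  : (xs ys : Sprinkler) (Φ : Bouquet ar) (Δ : Corolla ar) (σ : Subst) →
            σ ∶ ys → CapAvoidF σ ys (([] · Φ) ▷ Δ) →
            NRule [ ((xs ++ ys) · Φ) ▷ Δ ]
                  (((xs · sB σ Φ) ▷ sC σ Δ) ∷ [ ((xs ++ ys) · Φ) ▷ Δ ])
    ipet  : (γ : Garden ar) (xs ys : Sprinkler) (Φ : Bouquet ar) (Δ : Corolla ar) (σ : Subst) →
            σ ∶ ys → CapAvoidB σ ys Φ →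
            NRule [ γ ▷ (((xs ++ ys) · Φ) ∷ Δ) ]
                  [ γ ▷ ((xs · sB σ Φ) ∷ ((xs ++ ys) · Φ) ∷ Δ) ]

  data Step : Bouquet ar → Bouquet ar → Set where
    nat  : (Ξ : Ctx ar) {Φ Ψ : Bouquet ar} → NRule Φ Ψ → Step (Ξ ⟦ Φ ⟧) (Ξ ⟦ Ψ ⟧)
    grow : (Ξ : Ctx ar) → Positive Ξ → (Φ : Bouquet ar) → Step (Ξ ⟦ [] ⟧) (Ξ ⟦ Φ ⟧)
    crop : (Ξ : Ctx ar) → Negative Ξ → (Φ : Bouquet ar) → Step (Ξ ⟦ Φ ⟧) (Ξ ⟦ [] ⟧)
    pull : (Ξ : Ctx ar) → Positive Ξ → (γ : Garden ar) (Γ Δ : Corolla ar) →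
           Step (Ξ ⟦ [ γ ▷ (Γ ++ Δ) ] ⟧) (Ξ ⟦ [ γ ▷ Δ ] ⟧)
    glue : (Ξ : Ctx ar) → Negative Ξ → (γ : Garden ar) (Γ Δ : Corolla ar) →
           Step (Ξ ⟦ [ γ ▷ Δ ] ⟧) (Ξ ⟦ [ γ ▷ (Γ ++ Δ) ] ⟧)
    apis : (Ξ : Ctx ar) → Positive Ξ → (xs ys : Sprinkler) (Φ : Bouquet ar) (Δ : Corolla ar) (σ : Subst) →
           σ ∶ ys → CapAvoidF σ ys (([] · Φ) ▷ Δ) →
           Step (Ξ ⟦ [ (xs · sB σ Φ) ▷ sC σ Δ ] ⟧) (Ξ ⟦ [ ((xs ++ ys) · Φ) ▷ Δ ] ⟧)
    apet : (Ξ : Ctx ar) → Negative Ξ → (γ : Garden ar) (xs ys : Sprinkler) (Φ : Bouquet ar) (Δ : Corolla ar) (σ : Subst) →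
           σ ∶ ys → CapAvoidB σ ys Φ →
           Step (Ξ ⟦ [ γ ▷ ((xs · sB σ Φ) ∷ Δ) ] ⟧) (Ξ ⟦ [ γ ▷ (((xs ++ ys) · Φ) ∷ Δ) ] ⟧)

  -- structural equivalence: multisets up to permutation, sprinklers up to
  -- set equality, at every depth (every bouquet/corolla position is
  -- reachable by a context)
  data Equiv : Bouquet ar → Bouquet ar → Set where
    perm-bouquet : (Ξ : Ctx ar) {Φ Φ' : Bouquet ar} → Φ ↭ Φ' → Equiv (Ξ ⟦ Φ ⟧) (Ξ ⟦ Φ' ⟧)
    perm-corolla : (Ξ : Ctx ar) (γ : Garden ar) {Δ Δ' : Corolla ar} → Δ ↭ Δ' →
                   Equiv (Ξ ⟦ [ γ ▷ Δ ] ⟧) (Ξ ⟦ [ γ ▷ Δ' ] ⟧)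
    set-pistil   : (Ξ : Ctx ar) {xs xs' : Sprinkler} → xs ⊆ xs' → xs' ⊆ xs →
                   (Φ : Bouquet ar) (Δ : Corolla ar) →
                   Equiv (Ξ ⟦ [ (xs · Φ) ▷ Δ ] ⟧) (Ξ ⟦ [ (xs' · Φ) ▷ Δ ] ⟧)
    set-petal    : (Ξ : Ctx ar) (γ : Garden ar) {ys ys' : Sprinkler} → ys ⊆ ys' → ys' ⊆ ys →
                   (Φ : Bouquet ar) (Δ : Corolla ar) →
                   Equiv (Ξ ⟦ [ γ ▷ ((ys · Φ) ∷ Δ) ] ⟧) (Ξ ⟦ [ γ ▷ ((ys' · Φ) ∷ Δ) ] ⟧)

  _⟶_ : Bouquet ar → Bouquet ar → Set
  Φ ⟶ Ψ = Step Φ Ψ ⊎ Equiv Φ Ψ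

  _⟶*_ : Bouquet ar → Bouquet ar → Set
  _⟶*_ = Star _⟶_

-- Forward: replay the derivation of Φ ⟶* Ψ inside the petal of (Ψ ▷ Φ),
-- then pollinate the petal Ψ away from the identical pistil and erase the
-- now empty petal.  Backward: turn Φ into (∅ ▷ Φ), grow Ψ beside it,
-- pollinate a copy of Ψ into its pistil, and run the given refutation of
-- (Ψ ▷ Φ) next to the remaining Ψ.
module Submission where

open import Data.Nat using (ℕ; suc; _+_; _%_)
open import Data.Nat.DivMod using (%-distribˡ-+; m%n%n≡m%n)
open import Data.List using ([]; [_]; _++_; _∷_)
open import Data.List.Properties using (++-assoc; ++-identityʳ)
open import Data.List.Relation.Unary.All using (tabulate)
open import Data.List.Relation.Binary.Permutation.Propositional.Properties using (++-comm)
open import Data.Product using (_,_)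
open import Data.Sum using (inj₁; inj₂)
open import Function.Bundles using (_↣_; _⇔_; mk⇔)
open import Relation.Binary.PropositionalEquality
  using (_≡_; refl; sym; trans; cong; subst; subst₂; module ≡-Reasoning)
open import Relation.Binary.Construct.Closure.ReflexiveTransitive using (ε; _◅_; _◅◅_)
open import Defs

module _ {P : Set} {ar : P → ℕ} where

  fill-∘ᶜ : (Ξ Ξ' : Ctx ar) (X : Bouquet ar) → (Ξ ∘ᶜ Ξ') ⟦ X ⟧ ≡ Ξ ⟦ Ξ' ⟦ X ⟧ ⟧
  fill-∘ᶜ (Ψ ⸴ □) (Ψ' ⸴ ξ') X = ++-assoc Ψ Ψ' (ξ' ⟦ X ⟧₀)
  fill-∘ᶜ (Ψ ⸴ pis xs Ξ Δ) Ξ' X = cong (λ B → Ψ ++ [ (xs · B) ▷ Δ ]) (fill-∘ᶜ Ξ Ξ' X)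
  fill-∘ᶜ (Ψ ⸴ pet γ ys Ξ Δ) Ξ' X = cong (λ B → Ψ ++ [ γ ▷ ((ys · B) ∷ Δ) ]) (fill-∘ᶜ Ξ Ξ' X)

  inv-∘ᶜ : (Ξ Ξ' : Ctx ar) → inv (Ξ ∘ᶜ Ξ') ≡ inv Ξ + inv Ξ'
  inv-∘ᶜ (Ψ ⸴ □) (Ψ' ⸴ ξ') = refl
  inv-∘ᶜ (Ψ ⸴ pis xs Ξ Δ) Ξ' = cong suc (inv-∘ᶜ Ξ Ξ')
  inv-∘ᶜ (Ψ ⸴ pet γ ys Ξ Δ) Ξ' = inv-∘ᶜ Ξ Ξ'

  positive-∘ᶜ-parity : (Ξ Ξ' : Ctx ar) → Positive Ξ → inv (Ξ ∘ᶜ Ξ') % 2 ≡ inv Ξ' % 2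
  positive-∘ᶜ-parity Ξ Ξ' pos = begin
    inv (Ξ ∘ᶜ Ξ') % 2                  ≡⟨ cong (_% 2) (inv-∘ᶜ Ξ Ξ') ⟩
    (inv Ξ + inv Ξ') % 2               ≡⟨ %-distribˡ-+ (inv Ξ) (inv Ξ') 2 ⟩
    (inv Ξ % 2 + inv Ξ' % 2) % 2       ≡⟨ cong (λ r → (r + inv Ξ' % 2) % 2) pos ⟩
    inv Ξ' % 2 % 2                     ≡⟨ m%n%n≡m%n (inv Ξ') 2 ⟩
    inv Ξ' % 2                         ∎
    where open ≡-Reasoning

  via-∘ᶜ : (R : Bouquet ar → Bouquet ar → Set) (Ξ Ξ' : Ctx ar) {X Y : Bouquet ar} →
           R ((Ξ ∘ᶜ Ξ') ⟦ X ⟧) ((Ξ ∘ᶜ Ξ') ⟦ Y ⟧) → R (Ξ ⟦ Ξ' ⟦ X ⟧ ⟧) (Ξ ⟦ Ξ' ⟦ Y ⟧ ⟧)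
  via-∘ᶜ R Ξ Ξ' = subst₂ R (fill-∘ᶜ Ξ Ξ' _) (fill-∘ᶜ Ξ Ξ' _)

  Equiv-cong : (Ξ : Ctx ar) {A B : Bouquet ar} → Equiv A B → Equiv (Ξ ⟦ A ⟧) (Ξ ⟦ B ⟧)
  Equiv-cong Ξ (perm-bouquet Ξ' q) = via-∘ᶜ Equiv Ξ Ξ' (perm-bouquet (Ξ ∘ᶜ Ξ') q)
  Equiv-cong Ξ (perm-corolla Ξ' γ q) = via-∘ᶜ Equiv Ξ Ξ' (perm-corolla (Ξ ∘ᶜ Ξ') γ q)
  Equiv-cong Ξ (set-pistil Ξ' ⊆₁ ⊆₂ Φ Δ) = via-∘ᶜ Equiv Ξ Ξ' (set-pistil (Ξ ∘ᶜ Ξ') ⊆₁ ⊆₂ Φ Δ)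
  Equiv-cong Ξ (set-petal Ξ' γ ⊆₁ ⊆₂ Φ Δ) = via-∘ᶜ Equiv Ξ Ξ' (set-petal (Ξ ∘ᶜ Ξ') γ ⊆₁ ⊆₂ Φ Δ)

  Step-cong : (Ξ : Ctx ar) → Positive Ξ → {A B : Bouquet ar} → Step A B → Step (Ξ ⟦ A ⟧) (Ξ ⟦ B ⟧)
  Step-cong Ξ pos (nat Ξ' r) = via-∘ᶜ Step Ξ Ξ' (nat (Ξ ∘ᶜ Ξ') r)
  Step-cong Ξ pos (grow Ξ' p Φ) =
    via-∘ᶜ Step Ξ Ξ' (grow (Ξ ∘ᶜ Ξ') (trans (positive-∘ᶜ-parity Ξ Ξ' pos) p) Φ)
  Step-cong Ξ pos (crop Ξ' p Φ) =
    via-∘ᶜ Step Ξ Ξ' (crop (Ξ ∘ᶜ Ξ') (trans (positive-∘ᶜ-parity Ξ Ξ' pos) p) Φ)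
  Step-cong Ξ pos (pull Ξ' p γ Γ Δ) =
    via-∘ᶜ Step Ξ Ξ' (pull (Ξ ∘ᶜ Ξ') (trans (positive-∘ᶜ-parity Ξ Ξ' pos) p) γ Γ Δ)
  Step-cong Ξ pos (glue Ξ' p γ Γ Δ) =
    via-∘ᶜ Step Ξ Ξ' (glue (Ξ ∘ᶜ Ξ') (trans (positive-∘ᶜ-parity Ξ Ξ' pos) p) γ Γ Δ)
  Step-cong Ξ pos (apis Ξ' p xs ys Φ Δ σ supp cap) =
    via-∘ᶜ Step Ξ Ξ' (apis (Ξ ∘ᶜ Ξ') (trans (positive-∘ᶜ-parity Ξ Ξ' pos) p) xs ys Φ Δ σ supp cap)
  Step-cong Ξ pos (apet Ξ' p γ xs ys Φ Δ σ supp cap) =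
    via-∘ᶜ Step Ξ Ξ' (apet (Ξ ∘ᶜ Ξ') (trans (positive-∘ᶜ-parity Ξ Ξ' pos) p) γ xs ys Φ Δ σ supp cap)

  ⟶-cong : (Ξ : Ctx ar) → Positive Ξ → {A B : Bouquet ar} → A ⟶ B → (Ξ ⟦ A ⟧) ⟶ (Ξ ⟦ B ⟧)
  ⟶-cong Ξ pos (inj₁ s) = inj₁ (Step-cong Ξ pos s)
  ⟶-cong Ξ pos (inj₂ e) = inj₂ (Equiv-cong Ξ e)

  ⟶*-cong : (Ξ : Ctx ar) → Positive Ξ → {A B : Bouquet ar} → A ⟶* B → (Ξ ⟦ A ⟧) ⟶* (Ξ ⟦ B ⟧)
  ⟶*-cong Ξ pos ε = ε
  ⟶*-cong Ξ pos (s ◅ ss) = ⟶-cong Ξ pos s ◅ ⟶*-cong Ξ pos ss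

  pollinable-beside : (Ψ : Bouquet ar) (ξ : Ctx₀ ar) → Pollinable Ψ (Ψ ⸴ ξ)
  pollinable-beside Ψ ξ = tabulate λ φ∈Ψ →
    Ψ , φ∈Ψ , ([] ⸴ □) , ([] ⸴ ξ) , inj₁ (cong (_⸴ ξ) (sym (++-identityʳ Ψ)))

  pollinable-from-pistil : (xs : Sprinkler) (Ψ : Bouquet ar) (ys : Sprinkler) (Ξ : Ctx ar) (Δ : Corolla ar) →
                           Pollinable Ψ ([] ⸴ pet (xs · Ψ) ys Ξ Δ)
  pollinable-from-pistil xs Ψ ys Ξ Δ = tabulate λ φ∈Ψ →
    Ψ , φ∈Ψ , ([] ⸴ □) , Ξ , inj₂ (xs , ys , Δ , refl)

  internalize : (Φ Ψ : Bouquet ar) → Φ ⟶* Ψ → [ Ψ ⊳ Φ ] ⟶* []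
  internalize Φ Ψ d =
    ⟶*-cong petal refl d
    ◅◅ inj₁ (nat ([] ⸴ □) (poll↓ petal Ψ (pollinable-from-pistil [] Ψ [] ([] ⸴ □) [])))
    ◅ inj₁ (nat ([] ⸴ □) (epet ([] · Ψ) []))
    ◅ ε
    where
    petal : Ctx ar
    petal = [] ⸴ pet ([] · Ψ) [] ([] ⸴ □) []

  externalize : (Φ Ψ : Bouquet ar) → [ Ψ ⊳ Φ ] ⟶* [] → Φ ⟶* Ψ
  externalize Φ Ψ d =
    inj₁ (nat ([] ⸴ □) (epis Φ))
    ◅ inj₁ (grow ([ [] ⊳ Φ ] ⸴ □) refl Ψ)
    -- a context's hole always follows its bouquet, so Ψ is moved in front of the flower
    ◅ inj₂ (perm-bouquet ([] ⸴ □) (++-comm [ [] ⊳ Φ ] Ψ))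
    ◅ inj₁ (nat ([] ⸴ □) (poll↑ (Ψ ⸴ pistil) Ψ (pollinable-beside Ψ pistil)))
    ◅ subst ((Ψ ++ [ Ψ ⊳ Φ ]) ⟶*_) (++-identityʳ Ψ) (⟶*-cong (Ψ ⸴ □) refl d)
    where
    pistil : Ctx₀ ar
    pistil = pis [] ([] ⸴ □) [ [] · Φ ]

mainTheorem1 : {P : Set} → (P ↣ ℕ) → (ar : P → ℕ) → (Φ Ψ : Bouquet ar) →
    WF Φ → WF Ψ → WF [ Ψ ⊳ Φ ] →
    (Φ ⟶* Ψ) ⇔ ([ Ψ ⊳ Φ ] ⟶* [])
mainTheorem1 _ _ Φ Ψ _ _ _ = mk⇔ (internalize Φ Ψ) (externalize Φ Ψ)
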